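{- Let $s\ge 2$ and let $w$ be a word over $\Sigma_s$ with $\mathrm{core}_{a_{1,s}}(w)\neq\lambda$, and assume $\mathcal{G}(w)$ is connected. Then the diameter of $\mathcal{G}(w)$ is at most $s+3$ when $s\ge 3$, and at most $3$ when $s=2$.
   Context: $\Sigma_s$ denotes the ordered alphabet $\{a_1<a_2<\dots<a_s\}$, $a_{1,s}$ denotes the word $a_1a_2\cdots a_s$, and $\lambda$ is the empty word. For words $v,w$, $\mathrm{core}_v(w)$ is the subword of $w$ consisting of exactly those letters (occurrences) of $w$ that belong to at least one occurrence of $v$ as a (scattered) subword of $w$; so $\mathrm{core}_{a_{1,s}}(w)\ne\lambda$ means $a_1a_2\cdots a_s$ occurs as a scattered subword of $w$. For a nonempty word $w=w_1\cdots w_n$ over $\Sigma_s$, the Parikh graph $\mathcal{G}(w)$ is the simple undirected graph on $\{1,\dots,n\}$ where, for $i<j$, $i$ and $j$ are adjacent iff $w_i=a_k$ and $w_j=a_{k+1}$ for some $1\le k\le s-1$. -}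

module Defs where

open import Data.Nat using (ℕ; zero; suc; _≤_; _<_)
open import Data.Fin using (Fin; toℕ)
open import Data.List using (List; length; lookup)
open import Data.Product using (Σ; ∃; _×_; _,_)
open import Data.Sum using (_⊎_)
open import Relation.Binary.PropositionalEquality using (_≡_)

-- A word over Σ_s = {a_1 < ... < a_s}; the letter a_{k+1} is encoded as k : Fin s.
Word : ℕ → Set
Word s = List (Fin s)

Pos : ∀ {s} → Word s → Set
Pos w = Fin (length w)

letter : ∀ {s} (w : Word s) → Pos w → Fin s
letter w i = lookup w i

-- An occurrence of a_{1,s} = a_1 a_2 ... a_s as a scattered subword of w:
-- a strictly increasing choice of positions f(0) < ... < f(s-1) with w_{f(k)} = a_{k+1}.
record Occurrence {s} (w : Word s) : Set where
  field
    pos     : Fin s → Pos w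
    incr    : ∀ (k l : Fin s) → toℕ k < toℕ l → toℕ (pos k) < toℕ (pos l)
    matches : ∀ (k : Fin s) → letter w (pos k) ≡ k

-- core_{a_{1,s}}(w) ≠ λ : some letter occurrence of w belongs to some
-- occurrence of a_{1,s} as a scattered subword of w.
CoreNonempty : ∀ {s} → Word s → Set
CoreNonempty w = Σ (Pos w) λ p → Σ (Occurrence w) λ o → ∃ λ k → Occurrence.pos o k ≡ p

OrderedEdge : ∀ {s} (w : Word s) → Pos w → Pos w → Set
OrderedEdge w i j = toℕ i < toℕ j × suc (toℕ (letter w i)) ≡ toℕ (letter w j)

Adj : ∀ {s} (w : Word s) → Pos w → Pos w → Set
Adj w i j = OrderedEdge w i j ⊎ OrderedEdge w j i

data Walk {s} (w : Word s) : Pos w → Pos w → ℕ → Set where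
  here : ∀ {i} → Walk w i i zero
  step : ∀ {i j k n} → Adj w i j → Walk w j k n → Walk w i k (suc n)

DistAtMost : ∀ {s} (w : Word s) → ℕ → Pos w → Pos w → Set
DistAtMost w d i j = Σ ℕ λ n → n ≤ d × Walk w i j n

Connected : ∀ {s} → Word s → Set
Connected w = ∀ (i j : Pos w) → Σ ℕ λ n → Walk w i j n

-- diam G(w) ≤ d (for a connected graph: every pair at distance ≤ d).
DiameterAtMost : ∀ {s} → Word s → ℕ → Set
DiameterAtMost w d = ∀ (i j : Pos w) → DistAtMost w d i j

module Submission where

-- Fix an occurrence o of a_1 a_2 ... a_s in w, at positions pos 0 < ... < pos (s-1).
-- (1) Consecutive occurrence positions are adjacent, so any two of them are joined
--     by a walk of length at most s - 1 (the chain).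
-- (2) If G(w) is connected, every position v is within distance 2 of some occurrence
--     position (its anchor): compare v with pos k, where w_v = a_{k+1}.  Generically a
--     neighbouring letter of the occurrence lies on the correct side of v; otherwise
--     k is the first or the last letter, and then the neighbour u of v (which exists
--     by connectivity) is adjacent to pos k.
-- Hence any two positions are joined by anchor + chain + anchor, of length at most
-- 2 + (s - 1) + 2 = s + 3.
-- (3) For s = 2 a direct case analysis on the letters of the two endpoints, using
--     that a_1 only has later and a_2 only has earlier neighbours, gives diameter ≤ 3.

open import Defs
open import Data.Nat using (ℕ; zero; suc; pred; _≤_; _<_; _+_; _∸_; z≤n; s≤s; _<?_)
open import Data.Nat.Properties
open import Data.Fin using (Fin; zero; suc; toℕ; fromℕ<) renaming (_≟_ to _≟ᶠ_)
open import Data.Fin.Properties using (toℕ<n; toℕ-fromℕ<; toℕ-injective)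
open import Data.Product using (Σ; _×_; _,_)
open import Data.Sum using (inj₁; inj₂; swap)
open import Function using (_∘_)
open import Relation.Binary using (tri<; tri≈; tri>)
open import Relation.Binary.PropositionalEquality
open import Relation.Nullary using (yes; no; contradiction)

module Graph {s : ℕ} (w : Word s) where

  L : Pos w → ℕ
  L v = toℕ (letter w v)

  _▷_ : ∀ {i j k n} → Walk w i j n → Adj w j k → Walk w i k (suc n)
  here ▷ a = step a here
  step b p ▷ a = step b (p ▷ a)

  reverse : ∀ {i j n} → Walk w i j n → Walk w j i n
  reverse here = here
  reverse (step a p) = reverse p ▷ swap a

  _++_ : ∀ {i j k m n} → Walk w i j m → Walk w j k n → Walk w i k (m + n)
  here ++ q = q
  step a p ++ q = step a (p ++ q)

  dist-same : ∀ {d i j} → i ≡ j → DistAtMost w d i j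
  dist-same refl = 0 , z≤n , here

  adjacent : ∀ {i j} → Adj w i j → DistAtMost w 1 i j
  adjacent a = 1 , ≤-refl , step a here

  dist-mono : ∀ {d e i j} → d ≤ e → DistAtMost w d i j → DistAtMost w e i j
  dist-mono d≤e (n , n≤d , p) = n , ≤-trans n≤d d≤e , p

  dist-sym : ∀ {d i j} → DistAtMost w d i j → DistAtMost w d j i
  dist-sym (n , n≤d , p) = n , n≤d , reverse p

  dist-trans : ∀ {d e i j k} → DistAtMost w d i j → DistAtMost w e j k →
               DistAtMost w (d + e) i k
  dist-trans (m , m≤d , p) (n , n≤e , q) = m + n , +-mono-≤ m≤d n≤e , p ++ q

  neighbour-towards : Connected w → (v x : Pos w) → v ≢ x → Σ (Pos w) (Adj w v)
  neighbour-towards conn v x v≢x with conn v x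
  ... | _ , here = contradiction refl v≢x
  ... | _ , step a _ = _ , a

  neighbour : Connected w → (p q : Pos w) → p ≢ q → (v : Pos w) → Σ (Pos w) (Adj w v)
  neighbour conn p q p≢q v with v ≟ᶠ p
  ... | yes refl = neighbour-towards conn v q p≢q
  ... | no v≢p = neighbour-towards conn v p v≢p

  first-letter-neighbour : ∀ {v u} → L v ≡ 0 → Adj w v u → OrderedEdge w v u
  first-letter-neighbour _ (inj₁ vu) = vu
  first-letter-neighbour Lv≡0 (inj₂ (_ , e)) = contradiction (trans e Lv≡0) (λ ())

  last-letter-neighbour : ∀ {v u} → s ≤ suc (L v) → Adj w v u → OrderedEdge w u v
  last-letter-neighbour {u = u} s≤Lv+1 (inj₁ (_ , e)) =
    contradiction (subst (_< s) (sym e) (toℕ<n (letter w u))) (≤⇒≯ s≤Lv+1)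
  last-letter-neighbour _ (inj₂ uv) = uv

  -- Two positions with the same letter and later (resp. earlier) neighbours are at
  -- distance ≤ 2: the earlier of the two neighbours is adjacent to both positions.
  common-later-neighbour : ∀ {i j} → L i ≡ L j → Σ (Pos w) (OrderedEdge w i) →
                           Σ (Pos w) (OrderedEdge w j) → DistAtMost w 2 i j
  common-later-neighbour Li≡Lj (u , i<u , eu) (u' , j<u' , eu') with ≤-total (toℕ u) (toℕ u')
  ... | inj₁ u≤u' =
    dist-trans (adjacent (inj₁ (<-≤-trans i<u u≤u' , trans (cong suc Li≡Lj) eu')))
               (adjacent (inj₂ (j<u' , eu')))
  ... | inj₂ u'≤u =
    dist-trans (adjacent (inj₁ (i<u , eu)))
               (adjacent (inj₂ (<-≤-trans j<u' u'≤u , trans (cong suc (sym Li≡Lj)) eu)))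

  common-earlier-neighbour : ∀ {i j} → L i ≡ L j → Σ (Pos w) (λ u → OrderedEdge w u i) →
                             Σ (Pos w) (λ u → OrderedEdge w u j) → DistAtMost w 2 i j
  common-earlier-neighbour Li≡Lj (u , u<i , eu) (u' , u'<j , eu') with ≤-total (toℕ u) (toℕ u')
  ... | inj₁ u≤u' =
    dist-trans (adjacent (inj₂ (u<i , eu)))
               (adjacent (inj₁ (≤-<-trans u≤u' u'<j , trans eu Li≡Lj)))
  ... | inj₂ u'≤u =
    dist-trans (adjacent (inj₂ (≤-<-trans u'≤u u<i , trans eu' (sym Li≡Lj))))
               (adjacent (inj₁ (u'<j , eu')))

module WithOccurrence {s : ℕ} {w : Word s} (conn : Connected w) (o : Occurrence w) where
  open Occurrence o
  open Graph w

  letter-pos : ∀ k → L (pos k) ≡ toℕ k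
  letter-pos k = cong toℕ (matches k)

  edge-to-pos : ∀ {v} (l : Fin s) → toℕ v < toℕ (pos l) → suc (L v) ≡ toℕ l →
                OrderedEdge w v (pos l)
  edge-to-pos l v<l e = v<l , trans e (sym (letter-pos l))

  edge-from-pos : ∀ {v} (l : Fin s) → toℕ (pos l) < toℕ v → suc (toℕ l) ≡ L v →
                  OrderedEdge w (pos l) v
  edge-from-pos l l<v e = l<v , trans (cong suc (letter-pos l)) e

  -- (1) Consecutive occurrence positions are adjacent, so pos k and pos (k + d)
  -- are joined by a walk of length d.
  chain-walk : ∀ d (k l : Fin s) → toℕ k + d ≡ toℕ l → Walk w (pos k) (pos l) d
  chain-walk zero k l e with toℕ-injective (trans (sym (+-identityʳ (toℕ k))) e)
  ... | refl = here
  chain-walk (suc d) k l e =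
    step (inj₁ (edge-to-pos k' (incr k k' (≤-reflexive (sym k'≡k+1)))
                            (trans (cong suc (letter-pos k)) (sym k'≡k+1))))
         (chain-walk d k' l (trans (cong (_+ d) k'≡k+1) k+1+d≡l))
    where
    k+1+d≡l : suc (toℕ k + d) ≡ toℕ l
    k+1+d≡l = trans (sym (+-suc (toℕ k) d)) e
    k+1<s : suc (toℕ k) < s
    k+1<s = ≤-<-trans (≤-trans (s≤s (m≤m+n (toℕ k) d)) (≤-reflexive k+1+d≡l)) (toℕ<n l)
    k' : Fin s
    k' = fromℕ< k+1<s
    k'≡k+1 : toℕ k' ≡ suc (toℕ k)
    k'≡k+1 = toℕ-fromℕ< k+1<s

  chain-dist-up : (a b : Fin s) → toℕ a ≤ toℕ b → DistAtMost w (pred s) (pos a) (pos b)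
  chain-dist-up a b a≤b =
    toℕ b ∸ toℕ a , ≤-trans (m∸n≤m (toℕ b) (toℕ a)) (<⇒≤pred (toℕ<n b)) ,
    chain-walk _ a b (m+[n∸m]≡n a≤b)

  chain-dist : (a b : Fin s) → DistAtMost w (pred s) (pos a) (pos b)
  chain-dist a b with ≤-total (toℕ a) (toℕ b)
  ... | inj₁ a≤b = chain-dist-up a b a≤b
  ... | inj₂ b≤a = dist-sym (chain-dist-up b a b≤a)

  Anchored : Pos w → Set
  Anchored v = Σ (Fin s) λ a → DistAtMost w 2 v (pos a)

  anchor-before : (v : Pos w) → toℕ v < toℕ (pos (letter w v)) → Anchored v
  anchor-before v v<k with suc (L v) <? s
  ... | yes k+1<s =
    k' , dist-mono (s≤s z≤n) (adjacent (inj₁ (edge-to-pos k'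
            (<-trans v<k (incr (letter w v) k' (≤-reflexive (sym k'≡k+1)))) (sym k'≡k+1))))
    where
    k' = fromℕ< k+1<s
    k'≡k+1 : toℕ k' ≡ suc (L v)
    k'≡k+1 = toℕ-fromℕ< k+1<s
  ... | no k+1≮s with neighbour-towards conn v _ (<⇒≢ v<k ∘ cong toℕ)
  ... | u , v~u with last-letter-neighbour (≮⇒≥ k+1≮s) v~u
  ... | u<v , eu =
    letter w v , dist-trans (adjacent v~u)
                            (adjacent (inj₁ (edge-to-pos (letter w v) (<-trans u<v v<k) eu)))

  anchor-after : (v : Pos w) → toℕ (pos (letter w v)) < toℕ v → Anchored v
  anchor-after v k<v with L v in Lv≡
  ... | suc m =
    k' , dist-mono (s≤s z≤n) (adjacent (inj₂ (edge-from-pos k'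
            (<-trans (incr k' (letter w v) k'<k) k<v) (trans (cong suc k'≡m) (sym Lv≡)))))
    where
    m<s : m < s
    m<s = <-trans (subst (m <_) (sym Lv≡) ≤-refl) (toℕ<n (letter w v))
    k' = fromℕ< m<s
    k'≡m : toℕ k' ≡ m
    k'≡m = toℕ-fromℕ< m<s
    k'<k : toℕ k' < toℕ (letter w v)
    k'<k = subst₂ _<_ (sym k'≡m) (sym Lv≡) ≤-refl
  ... | zero with neighbour-towards conn v _ (<⇒≢ k<v ∘ cong toℕ ∘ sym)
  ... | u , v~u with first-letter-neighbour Lv≡ v~u
  ... | v<u , eu =
    letter w v , dist-trans (adjacent v~u)
                            (adjacent (inj₂ (edge-from-pos (letter w v) (<-trans k<v v<u) eu)))

  anchor : (v : Pos w) → Anchored v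
  anchor v with <-cmp (toℕ v) (toℕ (pos (letter w v)))
  ... | tri< v<k _ _ = anchor-before v v<k
  ... | tri≈ _ v≡k _ = letter w v , dist-same (toℕ-injective v≡k)
  ... | tri> _ _ k<v = anchor-after v k<v

  -- anchor + chain + anchor.
  diameter-bound : 1 ≤ s → DiameterAtMost w (s + 3)
  diameter-bound 1≤s i j with anchor i | anchor j
  ... | a , i~a | b , j~b =
    subst (λ d → DistAtMost w d i j) (length-bound 1≤s)
          (dist-trans i~a (dist-trans (chain-dist a b) (dist-sym j~b)))
    where
    length-bound : ∀ {s} → 1 ≤ s → 2 + (pred s + 2) ≡ s + 3
    length-bound {suc t} _ = cong suc (sym (+-suc t 2))

module TwoLetters {w : Word 2} (conn : Connected w) (o : Occurrence w) where
  open Occurrence o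
  open Graph w

  -- pos 0 ≠ pos 1, so by connectivity every vertex has a neighbour.
  has-neighbour : (v : Pos w) → Σ (Pos w) (Adj w v)
  has-neighbour = neighbour conn (pos zero) (pos (suc zero))
                            (<⇒≢ (incr zero (suc zero) ≤-refl) ∘ cong toℕ)

  later-neighbour : ∀ {v} → L v ≡ 0 → Σ (Pos w) (OrderedEdge w v)
  later-neighbour {v} Lv≡0 with has-neighbour v
  ... | u , v~u = u , first-letter-neighbour Lv≡0 v~u

  earlier-neighbour : ∀ {v} → L v ≡ 1 → Σ (Pos w) (λ u → OrderedEdge w u v)
  earlier-neighbour {v} Lv≡1 with has-neighbour v
  ... | u , v~u = u , last-letter-neighbour (≤-reflexive (cong suc (sym Lv≡1))) v~u

  -- i carries a_1 and j carries a_2.  If i < j they are adjacent; otherwise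
  -- y < j < i < u for neighbours u of i and y of j, and i – u – y – j is a walk.
  first-to-second : ∀ {i j} → L i ≡ 0 → L j ≡ 1 → DistAtMost w 3 i j
  first-to-second {i} {j} Li≡0 Lj≡1 with <-cmp (toℕ i) (toℕ j)
  ... | tri< i<j _ _ =
    dist-mono (s≤s z≤n) (adjacent (inj₁ (i<j , trans (cong suc Li≡0) (sym Lj≡1))))
  ... | tri≈ _ i≡j _ =
    contradiction (trans (sym Li≡0) (trans (cong L (toℕ-injective i≡j)) Lj≡1)) (λ ())
  ... | tri> _ _ j<i with later-neighbour Li≡0 | earlier-neighbour Lj≡1
  ... | u , i<u , eu | y , y<j , ey =
    dist-trans (adjacent (inj₁ (i<u , eu)))
      (dist-trans (adjacent (inj₂ (<-trans y<j (<-trans j<i i<u) , y→u)))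
                  (adjacent (inj₁ (y<j , ey))))
    where
    y→u : suc (L y) ≡ L u
    y→u = begin
      suc (L y)  ≡⟨ ey ⟩
      L j        ≡⟨ Lj≡1 ⟩
      1          ≡⟨ cong suc (sym Li≡0) ⟩
      suc (L i)  ≡⟨ eu ⟩
      L u        ∎
      where open ≡-Reasoning

  diameter-two-letters : DiameterAtMost w 3
  diameter-two-letters i j with letter w i in ei | letter w j in ej
  ... | zero | zero =
    dist-mono (n≤1+n 2) (common-later-neighbour (trans Li≡ (sym Lj≡))
                          (later-neighbour Li≡) (later-neighbour Lj≡))
    where Li≡ = cong toℕ ei; Lj≡ = cong toℕ ej
  ... | zero | suc zero = first-to-second (cong toℕ ei) (cong toℕ ej)
  ... | suc zero | zero = dist-sym (first-to-second (cong toℕ ej) (cong toℕ ei))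
  ... | suc zero | suc zero =
    dist-mono (n≤1+n 2) (common-earlier-neighbour (trans Li≡ (sym Lj≡))
                          (earlier-neighbour Li≡) (earlier-neighbour Lj≡))
    where Li≡ = cong toℕ ei; Lj≡ = cong toℕ ej

theorem5p2 : ∀ (s : ℕ) → 2 ≤ s → (w : Word s) → CoreNonempty w → Connected w →
    (3 ≤ s → DiameterAtMost w (s + 3)) × (s ≡ 2 → DiameterAtMost w 3)
theorem5p2 s 2≤s w (_ , o , _) conn =
  (λ _ → WithOccurrence.diameter-bound conn o (≤-trans (s≤s z≤n) 2≤s)) ,
  λ { refl → TwoLetters.diameter-two-letters conn o }
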